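{- Let $n\ge1$ and let $w$ be a Kreweras word of length $3n$, with $\sigma_w$ defined as in the context. Then: (a) $\sigma_w$ is a permutation of $\{1,\dots,3n\}$; (b) if $w_i=\mathsf A$, then $w_{\sigma_w(i)}\in\{\mathsf B,\mathsf C\}$; (c) if $w_i\in\{\mathsf B,\mathsf C\}$, then either $w_{\sigma_w(i)}=-w_i$, or $w_{\sigma_w(i)}=\mathsf A$ and $w_{\sigma_w(\sigma_w(i))}=-w_i$; (d) $\{i\in[3n]: w_i=\mathsf A\}=\{i\in[3n]:\sigma_w^{ -1}(i)>i\}$ and $\{i\in[3n]: w_i\in\{\mathsf B,\mathsf C\}\}=\{i\in[3n]:\sigma_w^{ -1}(i)<i\}$; in particular $\sigma_w$ has no fixed points.
   Context: Convention: $-\mathsf B=\mathsf C$ and $-\mathsf C=\mathsf B$. A Kreweras word of length $3n$ is a word $w=(w_1,\dots,w_{3n})$ in letters $\mathsf A,\mathsf B,\mathsf C$ with $n$ of each letter such that every prefix has at least as many $\mathsf A$'s as $\mathsf B$'s and at least as many $\mathsf A$'s as $\mathsf C$'s. For $\varepsilon\in\{\mathsf B,\mathsf C\}$ let $M^\varepsilon_w$ be the unique noncrossing perfect matching of $\{i:w_i\in\{\mathsf A,\varepsilon\}\}$ by arcs $(i,j)$, $i<j$, with $w_i=\mathsf A$, $w_j=\varepsilon$ (noncrossing: no arcs $(i,j),(k,l)$ with $i<k<j<l$). Arcs $(a,b),(c,d)$ of $M^{\mathsf B}_w\cup M^{\mathsf C}_w$ cross if $a\le c<b<d$. Draw $1,\dots,3n$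 in order on a horizontal line and each arc as a curve in the upper half plane joining its endpoints so that two arcs meet iff they cross, exactly once (arcs $(a,b),(a,d)$ meet at the point $a$). For $i\in\{1,\dots,3n\}$ take a walk from $i$: if $w_i\ne\mathsf A$ start along the unique arc containing $i$; if $w_i=\mathsf A$ start along the arc $(i,i')$ containing $i$ with the smaller $i'$. At the meeting point of crossing arcs $(a,b),(c,d)$ with $a\le c<b<d$, continue towards $b$ if coming from $a$, towards $a$ if coming from $c$, towards $d$ if coming from $b$, towards $c$ if coming from $d$. The walk stops on reaching a point $j\in\{1,\dots,3n\}$ where these rules do not send it on (arriving at $a$ along $(a,b)$ from $b$, where $(a,b),(a,d)$, $b<d$, are the arcs at $a$, it continues along $(a,d)$ towards $d$). Set $\sigma_w(i)=j$. -}

module Defs where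

open import Data.Nat using (ℕ; zero; suc; _+_; _*_; _∸_; _≤_; _<_)
open import Data.Fin using (Fin; toℕ) renaming (_<_ to _<F_; _≤_ to _≤F_)
open import Data.Vec using (Vec; lookup; toList)
open import Data.List using (List; []; _∷_; take)
open import Data.Product using (Σ; Σ-syntax; _×_; _,_)
open import Data.Sum using (_⊎_)
open import Relation.Binary.PropositionalEquality using (_≡_; _≢_)
open import Relation.Nullary using (¬_)

data Letter : Set where
  A B C : Letter

-- the convention -B = C, -C = B  (the value on A is irrelevant)
neg : Letter → Letter
neg A = A
neg B = C
neg C = B

count : Letter → List Letter → ℕ
count x [] = 0
count A (A ∷ l) = suc (count A l)
count B (B ∷ l) = suc (count B l)
count C (C ∷ l) = suc (count C l)
count A (B ∷ l) = count A l
count A (C ∷ l) = count A l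
count B (A ∷ l) = count B l
count B (C ∷ l) = count B l
count C (A ∷ l) = count C l
count C (B ∷ l) = count C l

IsKreweras : (n : ℕ) → Vec Letter (3 * n) → Set
IsKreweras n w =
  count A (toList w) ≡ n × count B (toList w) ≡ n × count C (toList w) ≡ n ×
  (∀ k → count B (take k (toList w)) ≤ count A (take k (toList w))
       × count C (take k (toList w)) ≤ count A (take k (toList w)))

-- Positions are Fin N (0-based; the 1-based labels of the paper are
-- toℕ i + 1, which changes nothing below since only order matters and
-- the drawing is translation invariant).

module _ {N : ℕ} (w : Vec Letter N) where

  letter : Fin N → Letter
  letter i = lookup w i

  -- M (given as a relation: M i j means (i,j) is an arc) is a
  -- noncrossing perfect matching of {i : w_i ∈ {A, ε}} by arcs (i,j),
  -- i < j, w_i = A, w_j = ε.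
  IsNCMatching : Letter → (Fin N → Fin N → Set) → Set
  IsNCMatching ε M =
    (∀ i j → M i j → (i <F j) × letter i ≡ A × letter j ≡ ε) ×
    (∀ i → letter i ≡ A → Σ[ j ∈ Fin N ] (M i j × (∀ j′ → M i j′ → j′ ≡ j))) ×
    (∀ j → letter j ≡ ε → Σ[ i ∈ Fin N ] (M i j × (∀ i′ → M i′ j → i′ ≡ i))) ×
    (∀ i j k l → M i j → M k l → ¬ ((i <F k) × (k <F j) × (j <F l)))

-- We draw every arc (a,b) as the semicircle with diameter [a,b].  Two such
-- semicircles (a,b), (c,d) with a ≤ c < b < d meet exactly once, at the
-- point with x-coordinate (cd - ab)/(c + d - a - b) (which is a when a = c),
-- and semicircles of non-crossing arcs do not meet; so this is a drawing as
-- required.  Along an arc, points are ordered by their x-coordinate.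

-- a (nonnegative rational) x-coordinate p/q, q > 0, as a pair (p , q)
Pos : Set
Pos = ℕ × ℕ

_<ₚ_ : Pos → Pos → Set
(p , q) <ₚ (p′ , q′) = p * q′ < p′ * q

pt : ℕ → Pos
pt a = (a , 1)

meetX : ℕ → ℕ → ℕ → ℕ → Pos
meetX a b c d = (c * d ∸ a * b , (c + d) ∸ (a + b))

data Dir : Set where
  L R : Dir

Beyond : Dir → Pos → Pos → Set
Beyond R x y = x <ₚ y
Beyond L x y = y <ₚ x

Arc : ℕ → Set
Arc N = Fin N × Fin N

-- the role an arc plays at a meeting point of crossing arcs (a,b),(c,d)
-- with a ≤ c < b < d:  first = it is (a,b),  second = it is (c,d)
data Role : Set where
  first second : Role

module Walk {N : ℕ} (w : Vec Letter N) (MB MC : Fin N → Fin N → Set) where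

  InU : Fin N → Fin N → Set
  InU i j = MB i j ⊎ MC i j

  Crosses : Arc N → Arc N → Set
  Crosses (a , b) (c , d) = InU a b × InU c d × a ≤F c × c <F b × b <F d

  xOf : Arc N → Arc N → Pos
  xOf (a , b) (c , d) = meetX (toℕ a) (toℕ b) (toℕ c) (toℕ d)

  data Meets (α β : Arc N) : Pos → Role → Set where
    asFirst  : Crosses α β → Meets α β (xOf α β) first
    asSecond : Crosses β α → Meets α β (xOf β α) second

  Next : Arc N → Dir → Pos → Arc N → Pos → Role → Set
  Next α d x β y r =
    Meets α β y r × Beyond d x y ×
    (∀ γ z r′ → Meets α γ z r′ → Beyond d x z → ¬ Beyond d z y)

  Last : Arc N → Dir → Pos → Set
  Last α d x = ∀ γ z r → Meets α γ z r → ¬ Beyond d x z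

  endpoint : Arc N → Dir → Fin N
  endpoint (a , b) L = a
  endpoint (a , b) R = b

  -- Rules at a meeting point of (a,b),(c,d), a ≤ c < b < d:
  --   coming from a (on (a,b), going R) : continue towards b
  --   coming from c (on (c,d), going R) : continue towards a (on (a,b), L)
  --   coming from b (on (a,b), going L) : continue towards d (on (c,d), R)
  --   coming from d (on (c,d), going L) : continue towards c
  -- (for a = c the meeting point is the point a itself, and these rules
  -- give exactly the behaviour described at a shared left endpoint)
  data Reaches : Arc N → Dir → Pos → Fin N → Set where
    stop   : ∀ {α d x} → Last α d x → Reaches α d x (endpoint α d)
    fromA  : ∀ {α x β y j} → Next α R x β y first → Reaches α R y j → Reaches α R x j
    fromC  : ∀ {α x β y j} → Next α R x β y second → Reaches β L y j → Reaches α R x j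
    fromB  : ∀ {α x β y j} → Next α L x β y first → Reaches β R y j → Reaches α L x j
    fromD  : ∀ {α x β y j} → Next α L x β y second → Reaches α L y j → Reaches α L x j

  WalkFrom : Fin N → Fin N → Set
  WalkFrom i j =
    (letter w i ≡ A × Σ[ i′ ∈ Fin N ] (InU i i′ × (∀ k → InU i k → i′ ≤F k)
                                       × Reaches (i , i′) R (pt (toℕ i)) j))
    ⊎ (letter w i ≢ A × Σ[ k ∈ Fin N ] (InU k i × Reaches (k , i) L (pt (toℕ i)) j))

{-# OPTIONS --safe #-}
module Submission where

open import Defs
open import Data.Empty using (⊥; ⊥-elim)
open import Data.Fin using (Fin; toℕ; punchOut) renaming (_<_ to _<F_)
open import Data.Fin.Permutation using (Permutation′; permutation; _⟨$⟩ʳ_; _⟨$⟩ˡ_; inverseʳ)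
open import Data.Fin.Properties using (any?; pigeonhole; punchOut-injective; toℕ-injective)
  renaming (_≟_ to _≟F_)
open import Data.List using (List; []; _∷_; allFin; cartesianProduct)
open import Data.List.Membership.Propositional using (_∈_)
open import Data.List.Membership.Propositional.Properties using (∈-cartesianProduct⁺; ∈-allFin)
open import Data.List.Relation.Unary.Any using (here; there)
open import Data.Maybe using (Maybe; just; nothing)
open import Data.Nat using (ℕ; zero; suc; _+_; _*_; _∸_; _≤_; _<_; _≤?_; _<?_; z≤n; s≤s; z<s; >-nonZero)
open import Data.Nat.Induction using (<-wellFounded)
open import Data.Nat.Properties
open import Data.Nat.Tactic.RingSolver using (solve-∀)
open import Data.Product using (Σ-syntax; _×_; _,_; proj₁; proj₂)
open import Data.Sum using (_⊎_; inj₁; inj₂)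
open import Data.Unit using (⊤; tt)
open import Data.Vec using (Vec)
open import Function using (_∘_; flip; id)
open import Function.Bundles using (_⇔_; mk⇔; Equivalence)
open import Function.Properties.Equivalence using () renaming (sym to ⇔-sym; trans to ⇔-trans)
open import Induction.WellFounded using (Acc; acc)
open import Relation.Binary using (tri<; tri≈; tri>)
open import Relation.Binary.Construct.Closure.ReflexiveTransitive using (Star; ε; _◅_; reverse)
open import Relation.Binary.PropositionalEquality
open import Relation.Nullary using (¬_; Dec; yes; no)


-- A walk is a sequence of legs, straight runs along one arc: a leg crosses the meetings where
-- the role of its arc lets the walk go on, and turns onto the other arc at the nearest meeting
-- of the other role.  From an A the walk takes its shorter arc, which no arc crosses from the
-- left, straight to that arc's right end.  From a B or C point j with arc (k, j) of colour X,
-- every rightward leg turns onto an arc of colour X enclosing the arc it was entered from, so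
-- left endpoints decrease and the walk ends: at the A of an enclosing X-arc, which must be the
-- longer arc there, so that the shorter one has colour -X; or, right of j, at the end of an arc
-- of colour -X.  Turns and stops are injective on the legs a walk can produce, so a walk is
-- determined by its end point and the walk map is a permutation.  It moves every point right
-- onto a B or C, or left onto an A, which gives (d).

injective⇒surjective : ∀ {n} {f : Fin n → Fin n} → (∀ {x y} → f x ≡ f y → x ≡ y) →
                       ∀ y → Σ[ x ∈ Fin n ] f x ≡ y
injective⇒surjective {zero} _ ()
injective⇒surjective {suc m} {f} f-inj y with any? (λ x → f x ≟F y)
... | yes hit = hit
... | no miss = collision (pigeonhole (n<1+n m) (λ x → punchOut (missed x)))
  where
  missed : ∀ x → y ≢ f x
  missed x e = miss (x , sym e)
  collision : (Σ[ i ∈ Fin (suc m) ] Σ[ j ∈ Fin (suc m) ]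
                 (i <F j × punchOut (missed i) ≡ punchOut (missed j))) →
              Σ[ x ∈ Fin (suc m) ] f x ≡ y
  collision (i , j , i<j , eq) =
    ⊥-elim (<-irrefl (cong toℕ (f-inj (punchOut-injective (missed i) (missed j) eq))) i<j)

injective⇒permutation : ∀ {n} (f : Fin n → Fin n) → (∀ {x y} → f x ≡ f y → x ≡ y) → Permutation′ n
injective⇒permutation f f-inj =
  permutation f (λ y → proj₁ (injective⇒surjective f-inj y))
                (λ y → proj₂ (injective⇒surjective f-inj y))
                (λ x → f-inj (proj₂ (injective⇒surjective f-inj (f x))))

module _ {S : Set} {R : S → S → Set}
         (R-injective : ∀ {u₁ u₂ v} → R u₁ v → R u₂ v → u₁ ≡ u₂)
         (Initial : S → Set) (initial-no-pred : ∀ {u v} → R u v → ¬ Initial v) where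

  private
    sources-unique′ : ∀ {f s₁ s₂} → Star (flip R) f s₁ → Star (flip R) f s₂ →
                      Initial s₁ → Initial s₂ → s₁ ≡ s₂
    sources-unique′ ε        ε        _  _  = refl
    sources-unique′ ε        (t ◅ _)  i₁ _  = ⊥-elim (initial-no-pred t i₁)
    sources-unique′ (t ◅ _)  ε        _  i₂ = ⊥-elim (initial-no-pred t i₂)
    sources-unique′ (t₁ ◅ p₁) (t₂ ◅ p₂) i₁ i₂ with refl ← R-injective t₁ t₂ =
      sources-unique′ p₁ p₂ i₁ i₂

  Star-initial-unique : ∀ {s₁ s₂ f} → Star R s₁ f → Star R s₂ f →
                        Initial s₁ → Initial s₂ → s₁ ≡ s₂
  Star-initial-unique p₁ p₂ = sources-unique′ (reverse id p₁) (reverse id p₂)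

module _ {A : Set} where

  countSat : {P : A → Set} → (∀ x → Dec (P x)) → List A → ℕ
  countSat P? [] = 0
  countSat P? (x ∷ xs) with P? x
  ... | yes _ = suc (countSat P? xs)
  ... | no  _ = countSat P? xs

  module _ {P Q : A → Set} (P? : ∀ x → Dec (P x)) (Q? : ∀ x → Dec (Q x))
           (P⇒Q : ∀ x → P x → Q x) where

    countSat-mono : ∀ xs → countSat P? xs ≤ countSat Q? xs
    countSat-mono [] = z≤n
    countSat-mono (x ∷ xs) with P? x | Q? x
    ... | yes _ | yes _  = s≤s (countSat-mono xs)
    ... | yes p | no ¬q  = ⊥-elim (¬q (P⇒Q x p))
    ... | no _  | yes _  = m≤n⇒m≤1+n (countSat-mono xs)
    ... | no _  | no _   = countSat-mono xs

    countSat-< : ∀ {y} xs → y ∈ xs → Q y → ¬ P y → countSat P? xs < countSat Q? xs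
    countSat-< (x ∷ xs) (here refl) q ¬p with P? x | Q? x
    ... | yes p | _     = ⊥-elim (¬p p)
    ... | no _  | yes _ = s≤s (countSat-mono xs)
    ... | no _  | no ¬q = ⊥-elim (¬q q)
    countSat-< (x ∷ xs) (there y∈xs) q ¬p with P? x | Q? x
    ... | yes _ | yes _ = s≤s (countSat-< xs y∈xs q ¬p)
    ... | yes p | no ¬q = ⊥-elim (¬q (P⇒Q x p))
    ... | no _  | yes _ = m≤n⇒m≤1+n (countSat-< xs y∈xs q ¬p)
    ... | no _  | no _  = countSat-< xs y∈xs q ¬p

-- Positions on the line

-- Cross-multiplication is transitive only through positive denominators.
Proper : Pos → Set
Proper (_ , q) = 0 < q

_≤ₚ_ : Pos → Pos → Set
(p , q) ≤ₚ (p′ , q′) = p * q′ ≤ p′ * q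

_<ₚ?_ : ∀ x y → Dec (x <ₚ y)
(p , q) <ₚ? (p′ , q′) = p * q′ <? p′ * q

≮ₚ⇒≥ₚ : ∀ {x y} → ¬ (x <ₚ y) → y ≤ₚ x
≮ₚ⇒≥ₚ {_ , _} {_ , _} = ≮⇒≥

<ₚ-irrefl : ∀ {x} → ¬ (x <ₚ x)
<ₚ-irrefl {_ , _} = <-irrefl refl

<ₚ-asym : ∀ {x y} → x <ₚ y → ¬ (y <ₚ x)
<ₚ-asym {_ , _} {_ , _} = <-asym

private
  swap₂₃ : ∀ a b c → a * b * c ≡ a * c * b
  swap₂₃ = solve-∀

≤<ₚ-trans : ∀ {x y z} → Proper x → x ≤ₚ y → y <ₚ z → x <ₚ z
≤<ₚ-trans {p₁ , q₁} {p₂ , q₂} {p₃ , q₃} q₁>0 h₁ h₂ =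
  *-cancelʳ-< _ (p₁ * q₃) (p₃ * q₁) (begin-strict
    p₁ * q₃ * q₂ ≡⟨ swap₂₃ p₁ q₃ q₂ ⟩
    p₁ * q₂ * q₃ ≤⟨ *-monoˡ-≤ q₃ h₁ ⟩
    p₂ * q₁ * q₃ ≡⟨ swap₂₃ p₂ q₁ q₃ ⟩
    p₂ * q₃ * q₁ <⟨ *-monoˡ-< q₁ {{>-nonZero q₁>0}} h₂ ⟩
    p₃ * q₂ * q₁ ≡⟨ swap₂₃ p₃ q₂ q₁ ⟩
    p₃ * q₁ * q₂ ∎)
  where open ≤-Reasoning

<≤ₚ-trans : ∀ {x y z} → Proper z → x <ₚ y → y ≤ₚ z → x <ₚ z
<≤ₚ-trans {p₁ , q₁} {p₂ , q₂} {p₃ , q₃} q₃>0 h₁ h₂ =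
  *-cancelʳ-< _ (p₁ * q₃) (p₃ * q₁) (begin-strict
    p₁ * q₃ * q₂ ≡⟨ swap₂₃ p₁ q₃ q₂ ⟩
    p₁ * q₂ * q₃ <⟨ *-monoˡ-< q₃ {{>-nonZero q₃>0}} h₁ ⟩
    p₂ * q₁ * q₃ ≡⟨ swap₂₃ p₂ q₁ q₃ ⟩
    p₂ * q₃ * q₁ ≤⟨ *-monoˡ-≤ q₁ h₂ ⟩
    p₃ * q₂ * q₁ ≡⟨ swap₂₃ p₃ q₂ q₁ ⟩
    p₃ * q₁ * q₂ ∎)
  where open ≤-Reasoning

<ₚ-trans : ∀ {x y z} → Proper x → x <ₚ y → y <ₚ z → x <ₚ z
<ₚ-trans {x@(_ , _)} {y@(_ , _)} {z} x-proper h₁ = ≤<ₚ-trans {x} {y} {z} x-proper (<⇒≤ h₁)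

≤ₚ-trans : ∀ {x y z} → Proper y → x ≤ₚ y → y ≤ₚ z → x ≤ₚ z
≤ₚ-trans {p₁ , q₁} {p₂ , q₂} {p₃ , q₃} q₂>0 h₁ h₂ =
  *-cancelʳ-≤ (p₁ * q₃) (p₃ * q₁) q₂ {{>-nonZero q₂>0}} (begin
    p₁ * q₃ * q₂ ≡⟨ swap₂₃ p₁ q₃ q₂ ⟩
    p₁ * q₂ * q₃ ≤⟨ *-monoˡ-≤ q₃ h₁ ⟩
    p₂ * q₁ * q₃ ≡⟨ swap₂₃ p₂ q₁ q₃ ⟩
    p₂ * q₃ * q₁ ≤⟨ *-monoˡ-≤ q₁ h₂ ⟩
    p₃ * q₂ * q₁ ≡⟨ swap₂₃ p₃ q₂ q₁ ⟩
    p₃ * q₁ * q₂ ∎)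
  where open ≤-Reasoning

pt-proper : ∀ {a} → Proper (pt a)
pt-proper = z<s

pt-mono-< : ∀ {a b} → a < b → pt a <ₚ pt b
pt-mono-< {a} {b} = subst₂ _<_ (sym (*-identityʳ a)) (sym (*-identityʳ b))

-- Meeting points of semicircles

private
  ≡+⇒∸≡ : ∀ {x y z} → x ≡ y + z → x ∸ y ≡ z
  ≡+⇒∸≡ {y = y} {z} refl = m+n∸m≡n y z

  ≤⇒gap : ∀ {a b} → a ≤ b → Σ[ g ∈ ℕ ] b ≡ a + g
  ≤⇒gap a≤b with g , eq ← m≤n⇒∃[o]m+o≡n a≤b = g , sym eq

  <⇒gap : ∀ {a b} → a < b → Σ[ g ∈ ℕ ] b ≡ a + (1 + g)
  <⇒gap {a} a<b with g , eq ← m≤n⇒∃[o]m+o≡n a<b = g , trans (sym eq) (sym (+-suc a g))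

  ≤-by-gap : ∀ {x y} D → y ≡ x + D → x ≤ y
  ≤-by-gap {x} D refl = m≤m+n x D

  <-by-gap : ∀ {x y} D → y ≡ x + D → 0 < D → x < y
  <-by-gap {x} D refl = m<m+n x

-- Writing c = a + u, b = c + 1 + v, d = b + 1 + w makes both truncated subtractions exact.
meetX-gaps : ∀ a b c d u v w → c ≡ a + u → b ≡ c + (1 + v) → d ≡ b + (1 + w) →
             meetX a b c d ≡ (a * (1 + w) + u * d , u + (1 + w))
meetX-gaps a b c d u v w refl refl refl =
  cong₂ _,_ (≡+⇒∸≡ {y = a * (a + u + (1 + v))} (numerator a u v w))
            (≡+⇒∸≡ {y = a + (a + u + (1 + v))} (denominator a u v w))
  where
  numerator : ∀ a u v w → (a + u) * (a + u + (1 + v) + (1 + w)) ≡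
              a * (a + u + (1 + v)) + (a * (1 + w) + u * (a + u + (1 + v) + (1 + w)))
  numerator = solve-∀
  denominator : ∀ a u v w → (a + u) + (a + u + (1 + v) + (1 + w)) ≡
                a + (a + u + (1 + v)) + (u + (1 + w))
  denominator = solve-∀

module _ {a b c d : ℕ} (a≤c : a ≤ c) (c<b : c < b) (b<d : b < d) where

  meetX-proper : Proper (meetX a b c d)
  meetX-proper with u , refl ← ≤⇒gap a≤c | v , refl ← <⇒gap c<b | w , refl ← <⇒gap b<d =
    subst Proper (sym (meetX-gaps a _ _ _ u v w refl refl refl)) (≤-trans (s≤s z≤n) (m≤n+m (1 + w) u))

  pt-≤-meetX : pt c ≤ₚ meetX a b c d
  pt-≤-meetX with u , refl ← ≤⇒gap a≤c | v , refl ← <⇒gap c<b | w , refl ← <⇒gap b<d =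
    subst (pt (a + u) ≤ₚ_) (sym (meetX-gaps a _ _ _ u v w refl refl refl))
      (≤-by-gap (u * (1 + v)) (cross-mult a u v w))
    where
    cross-mult : ∀ a u v w → (a * (1 + w) + u * (a + u + (1 + v) + (1 + w))) * 1 ≡
                    (a + u) * (u + (1 + w)) + u * (1 + v)
    cross-mult = solve-∀

  meetX-<-pt : meetX a b c d <ₚ pt b
  meetX-<-pt with u , refl ← ≤⇒gap a≤c | v , refl ← <⇒gap c<b | w , refl ← <⇒gap b<d =
    subst (_<ₚ pt (a + u + (1 + v))) (sym (meetX-gaps a _ _ _ u v w refl refl refl))
      (<-by-gap ((1 + v) * (1 + w)) (cross-mult a u v w) z<s)
    where
    cross-mult : ∀ a u v w → (a + u + (1 + v)) * (u + (1 + w)) ≡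
                    (a * (1 + w) + u * (a + u + (1 + v) + (1 + w))) * 1 + (1 + v) * (1 + w)
    cross-mult = solve-∀

meetX-shared-≤-pt : ∀ {a b d} → a < b → b < d → meetX a b a d ≤ₚ pt a
meetX-shared-≤-pt {a} a<b b<d with v , refl ← <⇒gap a<b | w , refl ← <⇒gap b<d =
  subst (_≤ₚ pt a) (sym (meetX-gaps a _ a _ 0 v w (sym (+-identityʳ a)) refl refl))
    (≤-by-gap 0 (cross-mult a v w))
  where
  cross-mult : ∀ a v w → a * (0 + (1 + w)) ≡ (a * (1 + w) + 0 * (a + (1 + v) + (1 + w))) * 1 + 0
  cross-mult = solve-∀

meetX-inner-<-outerˡ : ∀ {a₁ a₂ b₁ b₂ c d} → a₁ < a₂ → a₂ ≤ c → c < b₂ → b₂ < b₁ → b₁ < d →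
                       meetX a₂ b₂ c d <ₚ meetX a₁ b₁ c d
meetX-inner-<-outerˡ {a} h₁ h₂ h₃ h₄ h₅
  with g₁ , refl ← <⇒gap h₁ | g₂ , refl ← ≤⇒gap h₂ | g₃ , refl ← <⇒gap h₃
     | g₄ , refl ← <⇒gap h₄ | g₅ , refl ← <⇒gap h₅ =
  subst₂ _<ₚ_
    (sym (meetX-gaps (a + (1 + g₁)) _ _ _ g₂ g₃ (g₄ + (1 + g₅)) refl refl
                     (regroup (a + (1 + g₁) + g₂ + (1 + g₃)) g₄ g₅)))
    (sym (meetX-gaps a _ _ _ ((1 + g₁) + g₂) (g₃ + (1 + g₄)) g₅ (+-assoc a (1 + g₁) g₂)
                     (regroup (a + (1 + g₁) + g₂) g₃ g₄) refl))
    (<-by-gap _ (cross-mult a g₁ g₂ g₃ g₄ g₅) z<s)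
  where
  regroup : ∀ b g h → b + (1 + g) + (1 + h) ≡ b + (1 + (g + (1 + h)))
  regroup = solve-∀
  cross-mult : ∀ a g₁ g₂ g₃ g₄ g₅ →
      (a * (1 + g₅) + ((1 + g₁) + g₂) * (a + (1 + g₁) + g₂ + (1 + g₃) + (1 + g₄) + (1 + g₅)))
        * (g₂ + (1 + (g₄ + (1 + g₅))))
      ≡ ((a + (1 + g₁)) * (1 + (g₄ + (1 + g₅)))
          + g₂ * (a + (1 + g₁) + g₂ + (1 + g₃) + (1 + g₄) + (1 + g₅)))
        * (((1 + g₁) + g₂) + (1 + g₅))
        + ((1 + g₁) * (1 + g₃) * ((1 + g₄) + (1 + g₅))
           + g₂ * (g₂ + (1 + g₃) + (1 + g₄) + (1 + g₅)) * (1 + g₄)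
           + (1 + g₁) * (1 + g₄) * (g₂ + (1 + (g₄ + (1 + g₅)))))
  cross-mult = solve-∀

meetX-outer-<-innerʳ : ∀ {a b c₁ c₂ d₁ d₂} → a ≤ c₁ → c₁ < c₂ → c₂ < b → b < d₂ → d₂ < d₁ →
                       meetX a b c₁ d₁ <ₚ meetX a b c₂ d₂
meetX-outer-<-innerʳ {a} h₁ h₂ h₃ h₄ h₅
  with g₁ , refl ← ≤⇒gap h₁ | g₂ , refl ← <⇒gap h₂ | g₃ , refl ← <⇒gap h₃
     | g₄ , refl ← <⇒gap h₄ | g₅ , refl ← <⇒gap h₅ =
  subst₂ _<ₚ_
    (sym (meetX-gaps a _ _ _ g₁ (g₂ + (1 + g₃)) (g₄ + (1 + g₅)) refl
                     (regroup (a + g₁) g₂ g₃) (regroup (a + g₁ + (1 + g₂) + (1 + g₃)) g₄ g₅)))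
    (sym (meetX-gaps a _ _ _ (g₁ + (1 + g₂)) g₃ g₄ (+-assoc a g₁ (1 + g₂)) refl refl))
    (<-by-gap _ (cross-mult a g₁ g₂ g₃ g₄ g₅) z<s)
  where
  regroup : ∀ b g h → b + (1 + g) + (1 + h) ≡ b + (1 + (g + (1 + h)))
  regroup = solve-∀
  cross-mult : ∀ a g₁ g₂ g₃ g₄ g₅ →
      (a * (1 + g₄) + (g₁ + (1 + g₂)) * (a + g₁ + (1 + g₂) + (1 + g₃) + (1 + g₄)))
        * (g₁ + (1 + (g₄ + (1 + g₅))))
      ≡ (a * (1 + (g₄ + (1 + g₅))) + g₁ * (a + g₁ + (1 + g₂) + (1 + g₃) + (1 + g₄) + (1 + g₅)))
        * ((g₁ + (1 + g₂)) + (1 + g₄))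
        + ((1 + g₂) * (1 + g₄) * ((1 + g₂) + (1 + g₃) + (1 + g₄) + g₁)
           + (g₁ + (1 + g₂)) * (1 + g₃) * (1 + g₅)
           + (1 + g₂) * (1 + g₅) * ((g₁ + (1 + g₂)) + (1 + g₄)))
  cross-mult = solve-∀

data BC : Letter → Set where
  isB : BC B
  isC : BC C

BC? : ∀ x → BC x ⊎ x ≡ A
BC? A = inj₂ refl
BC? B = inj₁ isB
BC? C = inj₁ isC

BC≢A : ∀ {x} → BC x → x ≢ A
BC≢A isB ()
BC≢A isC ()

≢A⇒BC : ∀ {x} → x ≢ A → BC x
≢A⇒BC {x} x≢A with BC? x
... | inj₁ bc = bc
... | inj₂ x≡A = ⊥-elim (x≢A x≡A)

BC⇔≡B⊎≡C : ∀ {x} → BC x ⇔ (x ≡ B ⊎ x ≡ C)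
BC⇔≡B⊎≡C = mk⇔ (λ { isB → inj₁ refl ; isC → inj₂ refl })
               (λ { (inj₁ refl) → isB ; (inj₂ refl) → isC })

neg-BC : ∀ {x} → BC x → BC (neg x)
neg-BC isB = isC
neg-BC isC = isB

neg-≢ : ∀ {x} → BC x → neg x ≢ x
neg-≢ isB ()
neg-≢ isC ()

≢⇒≡neg : ∀ {x y} → BC x → BC y → y ≢ x → y ≡ neg x
≢⇒≡neg isB isB y≢x = ⊥-elim (y≢x refl)
≢⇒≡neg isB isC _   = refl
≢⇒≡neg isC isB _   = refl
≢⇒≡neg isC isC y≢x = ⊥-elim (y≢x refl)

module WalkAnalysis {N : ℕ} (w : Vec Letter N) (MB MC : Fin N → Fin N → Set)
                    (hB : IsNCMatching w B MB) (hC : IsNCMatching w C MC) where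

  open Walk w MB MC

  w[_] : Fin N → Letter
  w[ i ] = letter w i

  M : Letter → Fin N → Fin N → Set
  M A _ _ = ⊥
  M B = MB
  M C = MC

  M-isNC : ∀ {ε} → BC ε → IsNCMatching w ε (M ε)
  M-isNC isB = hB
  M-isNC isC = hC

  module _ {ε} (bc : BC ε) where

    private
      nc : IsNCMatching w ε (M ε)
      nc = M-isNC bc

    arc-< : ∀ {i j} → M ε i j → toℕ i < toℕ j
    arc-< m = proj₁ (proj₁ nc _ _ m)

    arc-leftA : ∀ {i j} → M ε i j → w[ i ] ≡ A
    arc-leftA m = proj₁ (proj₂ (proj₁ nc _ _ m))

    arc-rightε : ∀ {i j} → M ε i j → w[ j ] ≡ ε
    arc-rightε m = proj₂ (proj₂ (proj₁ nc _ _ m))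

    arc-uniqueʳ : ∀ {i j j′} → M ε i j → M ε i j′ → j ≡ j′
    arc-uniqueʳ {i} m m′ with _ , _ , unique ← proj₁ (proj₂ nc) i (arc-leftA m) =
      trans (unique _ m) (sym (unique _ m′))

    arc-uniqueˡ : ∀ {i i′ j} → M ε i j → M ε i′ j → i ≡ i′
    arc-uniqueˡ {j = j} m m′ with _ , _ , unique ← proj₁ (proj₂ (proj₂ nc)) j (arc-rightε m) =
      trans (unique _ m) (sym (unique _ m′))

    arc-noncrossing : ∀ {i j k l} → M ε i j → M ε k l →
                      ¬ (toℕ i < toℕ k × toℕ k < toℕ j × toℕ j < toℕ l)
    arc-noncrossing = proj₂ (proj₂ (proj₂ nc)) _ _ _ _

    rightPartner : ∀ i → w[ i ] ≡ A → Σ[ j ∈ Fin N ] M ε i j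
    rightPartner i i≡A with j , m , _ ← proj₁ (proj₂ nc) i i≡A = j , m

    leftPartner : ∀ j → w[ j ] ≡ ε → Σ[ i ∈ Fin N ] M ε i j
    leftPartner j j≡ε with i , m , _ ← proj₁ (proj₂ (proj₂ nc)) j j≡ε = i , m

    M? : ∀ i j → Dec (M ε i j)
    M? i j with BC? w[ i ]
    ... | inj₁ bcᵢ = no λ m → BC≢A bcᵢ (arc-leftA m)
    ... | inj₂ i≡A with k , m ← rightPartner i i≡A | j ≟F k
    ...   | yes refl = yes m
    ...   | no j≢k   = no λ m′ → j≢k (arc-uniqueʳ m′ m)

    arc-nested : ∀ {i j k l} → M ε i j → M ε k l → toℕ i < toℕ k → toℕ k < toℕ j →
                 toℕ l < toℕ j
    arc-nested {i} {j} {k} {l} m m′ i<k k<j with <-cmp (toℕ l) (toℕ j)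
    ... | tri< l<j _ _ = l<j
    ... | tri≈ _ l≡j _ =
      ⊥-elim (<-irrefl (cong toℕ (arc-uniqueˡ m (subst (M ε k) (toℕ-injective l≡j) m′))) i<k)
    ... | tri> _ _ j<l = ⊥-elim (arc-noncrossing m m′ (i<k , k<j , j<l))

  InU⇒M : ∀ {a b} → InU a b → BC w[ b ] × M w[ b ] a b
  InU⇒M (inj₁ m) rewrite arc-rightε isB m = isB , m
  InU⇒M (inj₂ m) rewrite arc-rightε isC m = isC , m

  M⇒InU : ∀ {ε a b} → BC ε → M ε a b → InU a b
  M⇒InU isB = inj₁
  M⇒InU isC = inj₂

  InU-BC : ∀ {a b} → InU a b → BC w[ b ]
  InU-BC = proj₁ ∘ InU⇒M

  InU-< : ∀ {a b} → InU a b → toℕ a < toℕ b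
  InU-< u = arc-< (InU-BC u) (proj₂ (InU⇒M u))

  InU-leftA : ∀ {a b} → InU a b → w[ a ] ≡ A
  InU-leftA u = arc-leftA (InU-BC u) (proj₂ (InU⇒M u))

  InU? : ∀ a b → Dec (InU a b)
  InU? a b with M? isB a b | M? isC a b
  ... | yes m | _     = yes (inj₁ m)
  ... | no _  | yes m = yes (inj₂ m)
  ... | no ¬b | no ¬c = no λ { (inj₁ m) → ¬b m ; (inj₂ m) → ¬c m }

  recolour : ∀ {ε c d} → InU c d → w[ d ] ≡ ε → M ε c d
  recolour {c = c} {d} u refl = proj₂ (InU⇒M u)

  -- Arcs and crossings

  left right : Arc N → ℕ
  left  (a , _) = toℕ a
  right (_ , b) = toℕ b

  colour : Arc N → Letter
  colour (_ , b) = w[ b ]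

  Crosses-colour : ∀ {α β} → Crosses α β → colour α ≢ colour β
  Crosses-colour {a , b} {c , d} (u₁ , u₂ , a≤c , c<b , b<d) same
    with bc , m₁ ← InU⇒M u₁ | m≤n⇒m<n∨m≡n a≤c
  ... | inj₁ a<c = arc-noncrossing bc m₁ (recolour u₂ (sym same)) (a<c , c<b , b<d)
  ... | inj₂ a≡c with refl ← toℕ-injective a≡c =
    <-irrefl (cong toℕ (arc-uniqueʳ bc m₁ (recolour u₂ (sym same)))) b<d

  Crosses? : ∀ α β → Dec (Crosses α β)
  Crosses? (a , b) (c , d)
    with InU? a b | InU? c d | toℕ a ≤? toℕ c | toℕ c <? toℕ b | toℕ b <? toℕ d
  ... | yes p₁ | yes p₂ | yes p₃ | yes p₄ | yes p₅ = yes (p₁ , p₂ , p₃ , p₄ , p₅)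
  ... | no ¬p  | _      | _      | _      | _      = no λ (p , _) → ¬p p
  ... | yes _  | no ¬p  | _      | _      | _      = no λ (_ , p , _) → ¬p p
  ... | yes _  | yes _  | no ¬p  | _      | _      = no λ (_ , _ , p , _) → ¬p p
  ... | yes _  | yes _  | yes _  | no ¬p  | _      = no λ (_ , _ , _ , p , _) → ¬p p
  ... | yes _  | yes _  | yes _  | yes _  | no ¬p  = no λ (_ , _ , _ , _ , p) → ¬p p

  Crosses-asym : ∀ {α β} → Crosses α β → ¬ Crosses β α
  Crosses-asym (_ , _ , _ , _ , b<d) (_ , _ , _ , _ , d<b) = <-asym b<d d<b

  xOf-proper : ∀ {α β} → Crosses α β → Proper (xOf α β)
  xOf-proper (_ , _ , a≤c , c<b , b<d) = meetX-proper a≤c c<b b<d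

  left-≤-xOf : ∀ {α β} → Crosses α β → pt (left β) ≤ₚ xOf α β
  left-≤-xOf (_ , _ , a≤c , c<b , b<d) = pt-≤-meetX a≤c c<b b<d

  xOf-<-right : ∀ {α β} → Crosses α β → xOf α β <ₚ pt (right α)
  xOf-<-right (_ , _ , a≤c , c<b , b<d) = meetX-<-pt a≤c c<b b<d

  xOf-shared-≤-left : ∀ {α β} → Crosses α β → left α ≡ left β → xOf α β ≤ₚ pt (left α)
  xOf-shared-≤-left {a , b} {c , d} (_ , _ , _ , c<b , b<d) a≡c
    with refl ← toℕ-injective a≡c = meetX-shared-≤-pt c<b b<d

  crossing-colour : ∀ {α β} → Crosses α β ⊎ Crosses β α → colour β ≡ neg (colour α)
  crossing-colour (inj₁ c@(uα , uβ , _)) = ≢⇒≡neg (InU-BC uα) (InU-BC uβ) (Crosses-colour c ∘ sym)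
  crossing-colour (inj₂ c@(uβ , uα , _)) = ≢⇒≡neg (InU-BC uα) (InU-BC uβ) (Crosses-colour c)

  co-crossing-colour : ∀ {α β γ} → Crosses α β ⊎ Crosses β α → Crosses α γ ⊎ Crosses γ α →
                       colour β ≡ colour γ
  co-crossing-colour cβ cγ = trans (crossing-colour cβ) (sym (crossing-colour cγ))

  -- β and γ have the same colour, so noncrossing forces γ to end before β starts.
  second-<-first : ∀ {α β γ} → Crosses α β → Crosses γ α → xOf γ α <ₚ xOf α β
  second-<-first {α@(a , b)} {β@(c , d)} {γ@(e , f)}
                 cαβ@(_ , uβ , a≤c , c<b , b<d) cγα@(uγ , _ , e≤a , a<f , f<b)
    with bβ , mβ ← InU⇒M uβ | recolour uγ (co-crossing-colour (inj₂ cγα) (inj₁ cαβ))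
       | m≤n⇒m<n∨m≡n (≤-trans e≤a a≤c)
  ... | mγ | inj₂ e≡c with refl ← toℕ-injective e≡c =
    ⊥-elim (<-irrefl (cong toℕ (sym (arc-uniqueʳ bβ mβ mγ))) (<-trans f<b b<d))
  ... | mγ | inj₁ e<c with <-cmp (toℕ c) (toℕ f)
  ...   | tri< c<f _ _ = ⊥-elim (<-asym (arc-nested bβ mγ mβ e<c c<f) (<-trans f<b b<d))
  ...   | tri≈ _ c≡f _ =
    ⊥-elim (BC≢A (InU-BC uγ) (trans (cong w[_] (sym (toℕ-injective c≡f))) (InU-leftA uβ)))
  ...   | tri> _ _ f<c =
    <ₚ-trans {xOf γ α} {pt (toℕ f)} {xOf α β} (xOf-proper cγα) (xOf-<-right cγα)
      (<≤ₚ-trans {pt (toℕ f)} {pt (toℕ c)} {xOf α β} (xOf-proper cαβ) (pt-mono-< f<c) (left-≤-xOf cαβ))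

  firsts-ordered : ∀ {α β γ} → Crosses α β → Crosses α γ →
                   β ≡ γ ⊎ xOf α β <ₚ xOf α γ ⊎ xOf α γ <ₚ xOf α β
  firsts-ordered {a , b} {c₁ , d₁} {c₂ , d₂}
                 cβ@(_ , uβ , a≤c₁ , c₁<b , b<d₁) cγ@(_ , uγ , a≤c₂ , c₂<b , b<d₂)
    with bβ , mβ ← InU⇒M uβ | recolour uγ (co-crossing-colour (inj₁ cγ) (inj₁ cβ))
       | <-cmp (toℕ c₁) (toℕ c₂)
  ... | mγ | tri≈ _ c₁≡c₂ _ with refl ← toℕ-injective c₁≡c₂ =
    inj₁ (cong (c₁ ,_) (arc-uniqueʳ bβ mβ mγ))
  ... | mγ | tri< c₁<c₂ _ _ = inj₂ (inj₁ (meetX-outer-<-innerʳ a≤c₁ c₁<c₂ c₂<b b<d₂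
                                  (arc-nested bβ mβ mγ c₁<c₂ (<-trans c₂<b b<d₁))))
  ... | mγ | tri> _ _ c₂<c₁ = inj₂ (inj₂ (meetX-outer-<-innerʳ a≤c₂ c₂<c₁ c₁<b b<d₁
                                  (arc-nested bβ mγ mβ c₂<c₁ (<-trans c₁<b b<d₂))))

  seconds-ordered : ∀ {α β γ} → Crosses β α → Crosses γ α →
                    β ≡ γ ⊎ xOf β α <ₚ xOf γ α ⊎ xOf γ α <ₚ xOf β α
  seconds-ordered {c , d} {a₁ , b₁} {a₂ , b₂}
                  cβ@(uβ , _ , a₁≤c , c<b₁ , b₁<d) cγ@(uγ , _ , a₂≤c , c<b₂ , b₂<d)
    with bβ , mβ ← InU⇒M uβ | recolour uγ (co-crossing-colour (inj₂ cγ) (inj₂ cβ))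
       | <-cmp (toℕ a₁) (toℕ a₂)
  ... | mγ | tri≈ _ a₁≡a₂ _ with refl ← toℕ-injective a₁≡a₂ =
    inj₁ (cong (a₁ ,_) (arc-uniqueʳ bβ mβ mγ))
  ... | mγ | tri< a₁<a₂ _ _ = inj₂ (inj₂ (meetX-inner-<-outerˡ a₁<a₂ a₂≤c c<b₂
                                  (arc-nested bβ mβ mγ a₁<a₂ (≤-<-trans a₂≤c c<b₁)) b₁<d))
  ... | mγ | tri> _ _ a₂<a₁ = inj₂ (inj₁ (meetX-inner-<-outerˡ a₂<a₁ a₁≤c c<b₁
                                  (arc-nested bβ mγ mβ a₂<a₁ (≤-<-trans a₁≤c c<b₂)) b₂<d))

  Meets-unique : ∀ {α β γ y z r r′} → Meets α β y r → Meets α γ z r′ →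
                 ¬ (y <ₚ z) → ¬ (z <ₚ y) → β ≡ γ × r ≡ r′
  Meets-unique (asFirst c₁) (asFirst c₂) ≮ ≯ with firsts-ordered c₁ c₂
  ... | inj₁ refl        = refl , refl
  ... | inj₂ (inj₁ y<z) = ⊥-elim (≮ y<z)
  ... | inj₂ (inj₂ z<y) = ⊥-elim (≯ z<y)
  Meets-unique (asSecond c₁) (asSecond c₂) ≮ ≯ with seconds-ordered c₁ c₂
  ... | inj₁ refl        = refl , refl
  ... | inj₂ (inj₁ y<z) = ⊥-elim (≮ y<z)
  ... | inj₂ (inj₂ z<y) = ⊥-elim (≯ z<y)
  Meets-unique (asFirst c₁)  (asSecond c₂) _ ≯ = ⊥-elim (≯ (second-<-first c₁ c₂))
  Meets-unique (asSecond c₁) (asFirst c₂)  ≮ _ = ⊥-elim (≮ (second-<-first c₂ c₁))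

  Meets-proper : ∀ {α β y r} → Meets α β y r → Proper y
  Meets-proper (asFirst c)  = xOf-proper c
  Meets-proper (asSecond c) = xOf-proper c

  Meets-position : ∀ {α γ z z′ r r′} → Meets α γ z r → Meets α γ z′ r′ → z ≡ z′
  Meets-position (asFirst _)  (asFirst _)   = refl
  Meets-position (asSecond _) (asSecond _)  = refl
  Meets-position (asFirst c)  (asSecond c′) = ⊥-elim (Crosses-asym c c′)
  Meets-position (asSecond c) (asFirst c′)  = ⊥-elim (Crosses-asym c c′)

  Next-unique : ∀ {α d x β β′ y y′ r r′} → Next α d x β y r → Next α d x β′ y′ r′ →
                β ≡ β′ × r ≡ r′ × y ≡ y′
  Next-unique {d = R} (m₁ , x<y , first₁) (m₂ , x<y′ , first₂)
    with refl , refl ← Meets-unique m₁ m₂ (first₂ _ _ _ m₁ x<y) (first₁ _ _ _ m₂ x<y′) =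
    refl , refl , Meets-position m₁ m₂
  Next-unique {d = L} (m₁ , y<x , first₁) (m₂ , y′<x , first₂)
    with refl , refl ← Meets-unique m₁ m₂ (first₁ _ _ _ m₂ y′<x) (first₂ _ _ _ m₁ y<x) =
    refl , refl , Meets-position m₁ m₂

  Next-¬Last : ∀ {α d x β y r} → Next α d x β y r → ¬ Last α d x
  Next-¬Last (m , beyond , _) last = last _ _ _ m beyond

  first≢second : first ≢ second
  first≢second ()

  Reaches-functional : ∀ {α d x j j′} → Reaches α d x j → Reaches α d x j′ → j ≡ j′
  Reaches-functional (stop _) (stop _) = refl
  Reaches-functional {α} {_} {x} (stop l) (fromA n _) = ⊥-elim (Next-¬Last {α} {R} {x} n l)
  Reaches-functional {α} {_} {x} (stop l) (fromC n _) = ⊥-elim (Next-¬Last {α} {R} {x} n l)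
  Reaches-functional {α} {_} {x} (stop l) (fromB n _) = ⊥-elim (Next-¬Last {α} {L} {x} n l)
  Reaches-functional {α} {_} {x} (stop l) (fromD n _) = ⊥-elim (Next-¬Last {α} {L} {x} n l)
  Reaches-functional {α} {_} {x} (fromA n _) (stop l) = ⊥-elim (Next-¬Last {α} {R} {x} n l)
  Reaches-functional {α} {_} {x} (fromC n _) (stop l) = ⊥-elim (Next-¬Last {α} {R} {x} n l)
  Reaches-functional {α} {_} {x} (fromB n _) (stop l) = ⊥-elim (Next-¬Last {α} {L} {x} n l)
  Reaches-functional {α} {_} {x} (fromD n _) (stop l) = ⊥-elim (Next-¬Last {α} {L} {x} n l)
  Reaches-functional {α} {_} {x} (fromA n₁ r₁) (fromA n₂ r₂)
    with refl , _ , refl ← Next-unique {α} {R} {x} n₁ n₂ = Reaches-functional r₁ r₂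
  Reaches-functional {α} {_} {x} (fromC n₁ r₁) (fromC n₂ r₂)
    with refl , _ , refl ← Next-unique {α} {R} {x} n₁ n₂ = Reaches-functional r₁ r₂
  Reaches-functional {α} {_} {x} (fromB n₁ r₁) (fromB n₂ r₂)
    with refl , _ , refl ← Next-unique {α} {L} {x} n₁ n₂ = Reaches-functional r₁ r₂
  Reaches-functional {α} {_} {x} (fromD n₁ r₁) (fromD n₂ r₂)
    with refl , _ , refl ← Next-unique {α} {L} {x} n₁ n₂ = Reaches-functional r₁ r₂
  Reaches-functional {α} {_} {x} (fromA n₁ _) (fromC n₂ _) =
    ⊥-elim (first≢second (proj₁ (proj₂ (Next-unique {α} {R} {x} n₁ n₂))))
  Reaches-functional {α} {_} {x} (fromC n₁ _) (fromA n₂ _) =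
    ⊥-elim (first≢second (sym (proj₁ (proj₂ (Next-unique {α} {R} {x} n₁ n₂)))))
  Reaches-functional {α} {_} {x} (fromB n₁ _) (fromD n₂ _) =
    ⊥-elim (first≢second (proj₁ (proj₂ (Next-unique {α} {L} {x} n₁ n₂))))
  Reaches-functional {α} {_} {x} (fromD n₁ _) (fromB n₂ _) =
    ⊥-elim (first≢second (sym (proj₁ (proj₂ (Next-unique {α} {L} {x} n₁ n₂)))))

  allArcs : List (Arc N)
  allArcs = cartesianProduct (allFin N) (allFin N)

  ∈-allArcs : ∀ γ → γ ∈ allArcs
  ∈-allArcs (a , b) = ∈-cartesianProduct⁺ (∈-allFin a) (∈-allFin b)

  Beyond? : ∀ d x y → Dec (Beyond d x y)
  Beyond? R x y = x <ₚ? y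
  Beyond? L x y = y <ₚ? x

  Beyond-irrefl : ∀ d x → ¬ Beyond d x x
  Beyond-irrefl R x = <ₚ-irrefl {x}
  Beyond-irrefl L x = <ₚ-irrefl {x}

  Beyond-trans : ∀ d {x y z} → Proper x → Proper z → Beyond d x y → Beyond d y z → Beyond d x z
  Beyond-trans R {x} {y} {z} x-proper _ x<y y<z = <ₚ-trans {x} {y} {z} x-proper x<y y<z
  Beyond-trans L {x} {y} {z} _ z-proper y<x z<y = <ₚ-trans {z} {y} {x} z-proper z<y y<x

  module _ (α : Arc N) (d : Dir) (x : Pos) where

    Ahead : Arc N → Set
    Ahead γ = Σ[ z ∈ Pos ] Σ[ r ∈ Role ] (Meets α γ z r × Beyond d x z)

    Ahead? : ∀ γ → Dec (Ahead γ)
    Ahead? γ with Crosses? α γ | Crosses? γ α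
    ... | yes c | _ with Beyond? d x (xOf α γ)
    ...   | yes b = yes (_ , _ , asFirst c , b)
    ...   | no ¬b = no λ { (_ , _ , asFirst _ , b) → ¬b b ; (_ , _ , asSecond c′ , _) → Crosses-asym c c′ }
    Ahead? γ | no ¬c | yes c with Beyond? d x (xOf γ α)
    ...   | yes b = yes (_ , _ , asSecond c , b)
    ...   | no ¬b = no λ { (_ , _ , asSecond _ , b) → ¬b b ; (_ , _ , asFirst c′ , _) → ¬c c′ }
    Ahead? γ | no ¬c | no ¬c′ =
      no λ { (_ , _ , asFirst c , _) → ¬c c ; (_ , _ , asSecond c , _) → ¬c′ c }

    aheadCount : ℕ
    aheadCount = countSat Ahead? allArcs

    NoneAhead : List (Arc N) → Set
    NoneAhead γs = ∀ γ → γ ∈ γs → ¬ Ahead γ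

    NoneCloser : Pos → List (Arc N) → Set
    NoneCloser y γs = ∀ γ → γ ∈ γs → ∀ z r → Meets α γ z r → Beyond d x z → ¬ Beyond d z y

    ClosestAhead : List (Arc N) → Set
    ClosestAhead γs = Σ[ β ∈ Arc N ] Σ[ y ∈ Pos ] Σ[ r ∈ Role ]
                        (Meets α β y r × Beyond d x y × NoneCloser y γs)

    closestAhead : ∀ γs → NoneAhead γs ⊎ ClosestAhead γs
    closestAhead [] = inj₁ λ _ ()
    closestAhead (γ ∷ γs) with closestAhead γs | Ahead? γ
    ... | inj₁ none | no ¬a = inj₁ λ { _ (here refl) → ¬a ; γ′ (there γ′∈) → none γ′ γ′∈ }
    ... | inj₂ (β , y , r , m , b , closest) | no ¬a =
      inj₂ (β , y , r , m , b ,
            λ { _ (here refl) z r′ m′ b′ → ⊥-elim (¬a (z , r′ , m′ , b′)) ; γ′ (there γ′∈) → closest γ′ γ′∈ })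
    ... | inj₁ none | yes (z , r , m , b) =
      inj₂ (γ , z , r , m , b ,
            λ { _ (here refl) z′ _ m′ _ → subst (λ t → ¬ Beyond d t z) (Meets-position m m′) (Beyond-irrefl d z)
              ; γ′ (there γ′∈) z′ r′ m′ b′ → ⊥-elim (none γ′ γ′∈ (z′ , r′ , m′ , b′)) })
    ... | inj₂ (β , y , r , m , b , closest) | yes (z , r₁ , m₁ , b₁) with Beyond? d z y
    ...   | yes z-before-y =
      inj₂ (γ , z , r₁ , m₁ , b₁ ,
            λ { _ (here refl) z′ _ m′ _ → subst (λ t → ¬ Beyond d t z) (Meets-position m₁ m′) (Beyond-irrefl d z)
              ; γ′ (there γ′∈) z′ r′ m′ b′ z′-before-z →
                  closest γ′ γ′∈ z′ r′ m′ b′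
                    (Beyond-trans d (Meets-proper m′) (Meets-proper m) z′-before-z z-before-y) })
    ...   | no ¬z-before-y =
      inj₂ (β , y , r , m , b ,
            λ { _ (here refl) z′ _ m′ _ → subst (λ t → ¬ Beyond d t y) (Meets-position m₁ m′) ¬z-before-y
              ; γ′ (there γ′∈) → closest γ′ γ′∈ })

  next-or-last : ∀ α d x → Last α d x ⊎ Σ[ β ∈ Arc N ] Σ[ y ∈ Pos ] Σ[ r ∈ Role ] Next α d x β y r
  next-or-last α d x with closestAhead α d x allArcs
  ... | inj₁ none = inj₁ λ γ z r m b → none γ (∈-allArcs γ) (z , r , m , b)
  ... | inj₂ (β , y , r , m , b , closest) = inj₂ (β , y , r , m , b , λ γ → closest γ (∈-allArcs γ))

  aheadCount-< : ∀ {α d x β y r} → Proper x → Next α d x β y r → aheadCount α d y < aheadCount α d x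
  aheadCount-< {α} {d} {x} {β} {y} {r} x-proper (m , x-before-y , _) =
    countSat-< (Ahead? α d y) (Ahead? α d x)
      (λ _ (z , r′ , m′ , b′) → z , r′ , m′ , Beyond-trans d x-proper (Meets-proper m′) x-before-y b′)
      allArcs (∈-allArcs β) (y , r , m , x-before-y)
      λ (z , r′ , m′ , b′) → Beyond-irrefl d y (subst (Beyond d y) (sym (Meets-position m m′)) b′)

  -- Legs of the walk

  -- leftward α (just σ): running left along α, entered from σ at their meeting point;
  -- leftward α nothing: entered at the right endpoint of α.  Likewise for rightward legs.
  data Leg : Set where
    leftward rightward : Arc N → Maybe (Arc N) → Leg

  entry : Leg → Pos
  entry (leftward  α nothing)  = pt (right α)
  entry (leftward  α (just σ)) = xOf α σ
  entry (rightward β nothing)  = pt (left β)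
  entry (rightward β (just κ)) = xOf κ β

  -- A leg is never entered at a shared left endpoint, and a walk only starts rightward on an arc
  -- that no arc crosses from the left.
  Valid : Leg → Set
  Valid (leftward  (a , b) nothing)  = InU a b
  Valid (leftward  α (just σ))       = Crosses α σ × left α < left σ
  Valid (rightward (a , b) nothing)  = InU a b × (∀ δ → ¬ Crosses δ (a , b))
  Valid (rightward β (just κ))       = Crosses κ β

  entry-proper : ∀ s → Valid s → Proper (entry s)
  entry-proper (leftward  α nothing)  _       = pt-proper {right α}
  entry-proper (leftward  _ (just _)) (c , _) = xOf-proper c
  entry-proper (rightward β nothing)  _       = pt-proper {left β}
  entry-proper (rightward _ (just _)) c       = xOf-proper c

  -- A leftward leg turns at the nearest meeting before its entry where it is the first arc
  -- (coming from b, go towards d), a rightward leg at the nearest meeting after its entry where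
  -- it is the second arc (coming from c, go towards a); meetings of the other role are crossed.
  data Turn : Leg → Leg → Set where
    turnL : ∀ {α m β} → Crosses α β → xOf α β <ₚ entry (leftward α m) →
            (∀ γ → Crosses α γ → xOf α β <ₚ xOf α γ → ¬ (xOf α γ <ₚ entry (leftward α m))) →
            Turn (leftward α m) (rightward β (just α))
    turnR : ∀ {β m γ} → Crosses γ β → entry (rightward β m) <ₚ xOf γ β →
            (∀ δ → Crosses δ β → entry (rightward β m) <ₚ xOf δ β → ¬ (xOf δ β <ₚ xOf γ β)) →
            Turn (rightward β m) (leftward γ (just β))

  data Stops : Leg → Fin N → Set where
    stopsL : ∀ {a b m} → (∀ γ → Crosses (a , b) γ → ¬ (xOf (a , b) γ <ₚ entry (leftward (a , b) m))) →
             Stops (leftward (a , b) m) a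
    stopsR : ∀ {a b m} → (∀ δ → Crosses δ (a , b) → ¬ (entry (rightward (a , b) m) <ₚ xOf δ (a , b))) →
             Stops (rightward (a , b) m) b

  ReachesFrom : Leg → Fin N → Set
  ReachesFrom (leftward  α m) = Reaches α L (entry (leftward α m))
  ReachesFrom (rightward β m) = Reaches β R (entry (rightward β m))

  data LegResult (s : Leg) (Ends : Fin N → Set) : Set where
    stops : ∀ {e} → Stops s e → Ends e → LegResult s Ends
    turns : ∀ {s′} → Turn s s′ → (∀ {e} → ReachesFrom s′ e → Ends e) → LegResult s Ends

  LegResult-map : ∀ {s Ends Ends′} → (∀ {e} → Ends e → Ends′ e) → LegResult s Ends → LegResult s Ends′
  LegResult-map f (stops st e) = stops st (f e)
  LegResult-map f (turns t k)  = turns t (f ∘ k)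

  module _ (α : Arc N) (m : Maybe (Arc N)) (p-proper : Proper (entry (leftward α m))) where

    private
      p : Pos
      p = entry (leftward α m)

    runLeft : ∀ x → Proper x → Acc _<_ (aheadCount α L x) → ¬ (p <ₚ x) →
              (∀ γ → Crosses α γ → ¬ (xOf α γ <ₚ x) → ¬ (xOf α γ <ₚ p)) →
              LegResult (leftward α m) (Reaches α L x)
    runLeft x x-proper (acc more) ¬p<x passed with next-or-last α L x
    ... | inj₁ last = stops (stopsL λ γ c → passed γ c (last γ _ _ (asFirst c))) (stop last)
    ... | inj₂ (β , _ , first , n@(asFirst c , y<x , closest)) =
      turns (turnL c (<≤ₚ-trans {xOf α β} {x} {p} p-proper y<x (≮ₚ⇒≥ₚ {p} {x} ¬p<x)) notBefore) (fromB n)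
      where
      notBefore : ∀ γ → Crosses α γ → xOf α β <ₚ xOf α γ → ¬ (xOf α γ <ₚ p)
      notBefore γ cγ y<z with xOf α γ <ₚ? x
      ... | yes z<x = ⊥-elim (closest γ _ _ (asFirst cγ) z<x y<z)
      ... | no ¬z<x = passed γ cγ ¬z<x
    ... | inj₂ (β , _ , second , n@(asSecond c , y<x , closest)) =
      LegResult-map (fromD n)
        (runLeft (xOf β α) (xOf-proper c) (more (aheadCount-< {α} {L} {x} x-proper n))
                 (<ₚ-asym {xOf β α} {p} (<≤ₚ-trans {xOf β α} {x} {p} p-proper y<x (≮ₚ⇒≥ₚ {p} {x} ¬p<x)))
                 passed′)
      where
      passed′ : ∀ γ → Crosses α γ → ¬ (xOf α γ <ₚ xOf β α) → ¬ (xOf α γ <ₚ p)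
      passed′ γ cγ ¬z<y with xOf α γ <ₚ? x
      ... | yes z<x = ⊥-elim (first≢second (proj₂ (Meets-unique (asFirst cγ) (asSecond c) ¬z<y
                                                      (closest γ _ _ (asFirst cγ) z<x))))
      ... | no ¬z<x = passed γ cγ ¬z<x

  module _ (β : Arc N) (m : Maybe (Arc N)) (p-proper : Proper (entry (rightward β m))) where

    private
      p : Pos
      p = entry (rightward β m)

    runRight : ∀ x → Proper x → Acc _<_ (aheadCount β R x) → ¬ (x <ₚ p) →
               (∀ δ → Crosses δ β → ¬ (x <ₚ xOf δ β) → ¬ (p <ₚ xOf δ β)) →
               LegResult (rightward β m) (Reaches β R x)
    runRight x x-proper (acc more) ¬x<p passed with next-or-last β R x
    ... | inj₁ last = stops (stopsR λ δ c → passed δ c (last δ _ _ (asSecond c))) (stop last)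
    ... | inj₂ (γ , _ , second , n@(asSecond c , x<y , closest)) =
      turns (turnR c (≤<ₚ-trans {p} {x} {xOf γ β} p-proper (≮ₚ⇒≥ₚ {x} {p} ¬x<p) x<y) notBefore) (fromC n)
      where
      notBefore : ∀ δ → Crosses δ β → p <ₚ xOf δ β → ¬ (xOf δ β <ₚ xOf γ β)
      notBefore δ cδ p<z with x <ₚ? xOf δ β
      ... | yes x<z = closest δ _ _ (asSecond cδ) x<z
      ... | no ¬x<z = ⊥-elim (passed δ cδ ¬x<z p<z)
    ... | inj₂ (γ , _ , first , n@(asFirst c , x<y , closest)) =
      LegResult-map (fromA n)
        (runRight (xOf β γ) (xOf-proper c) (more (aheadCount-< {β} {R} {x} x-proper n))
                  (<ₚ-asym {p} {xOf β γ} (≤<ₚ-trans {p} {x} {xOf β γ} p-proper (≮ₚ⇒≥ₚ {x} {p} ¬x<p) x<y))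
                  passed′)
      where
      passed′ : ∀ δ → Crosses δ β → ¬ (xOf β γ <ₚ xOf δ β) → ¬ (p <ₚ xOf δ β)
      passed′ δ cδ ¬y<z with x <ₚ? xOf δ β
      ... | yes x<z = ⊥-elim (first≢second (sym (proj₂ (Meets-unique (asSecond cδ) (asFirst c)
                                                          (closest δ _ _ (asSecond cδ) x<z) ¬y<z))))
      ... | no ¬x<z = passed δ cδ ¬x<z

  legResult : ∀ s → Valid s → LegResult s (ReachesFrom s)
  legResult (leftward α m) v =
    runLeft α m p-proper (entry (leftward α m)) p-proper (<-wellFounded _)
            (<ₚ-irrefl {entry (leftward α m)}) (λ _ _ ¬z<p → ¬z<p)
    where
    p-proper : Proper (entry (leftward α m))
    p-proper = entry-proper (leftward α m) v
  legResult (rightward β m) v =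
    runRight β m p-proper (entry (rightward β m)) p-proper (<-wellFounded _)
             (<ₚ-irrefl {entry (rightward β m)}) (λ _ _ ¬p<z → ¬p<z)
    where
    p-proper : Proper (entry (rightward β m))
    p-proper = entry-proper (rightward β m) v

  left-≤-entry : ∀ β m → Valid (rightward β m) → pt (left β) ≤ₚ entry (rightward β m)
  left-≤-entry β nothing  _ = ≤-refl
  left-≤-entry β (just κ) c = left-≤-xOf c

  Turn-valid : ∀ {s s′} → Valid s → Turn s s′ → Valid s′
  Turn-valid _ (turnL c _ _) = c
  Turn-valid {rightward β m} {leftward γ _} v (turnR c p<z _)
    with m≤n⇒m<n∨m≡n (proj₁ (proj₂ (proj₂ c)))
  ... | inj₁ lγ<lβ = c , lγ<lβ
  ... | inj₂ lγ≡lβ = ⊥-elim (≤⇒≯ (≤ₚ-trans {xOf γ β} {pt (left β)} {entry (rightward β m)} (pt-proper {left β})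
                                    (subst (λ t → xOf γ β ≤ₚ pt t) lγ≡lβ (xOf-shared-≤-left c lγ≡lβ))
                                    (left-≤-entry β m v))
                                  p<z)

  Step : Leg → Leg → Set
  Step s s′ = Valid s × Turn s s′

  right-meeting-encloses : ∀ {κ γ β} → Crosses κ β → Crosses γ β → xOf κ β <ₚ xOf γ β →
                           colour γ ≡ colour κ × left γ < left κ × right κ < right γ
  right-meeting-encloses {a₁ , b₁} {a₂ , b₂} {c , d}
                         cκ@(uκ , _ , a₁≤c , c<b₁ , b₁<d) cγ@(uγ , _ , a₂≤c , c<b₂ , b₂<d) y<z
    with bκ , mκ ← InU⇒M uκ | recolour uγ (co-crossing-colour (inj₂ cγ) (inj₂ cκ))
       | <-cmp (toℕ a₁) (toℕ a₂)
  ... | mγ | tri≈ _ a₁≡a₂ _ with refl ← toℕ-injective a₁≡a₂ =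
    ⊥-elim (<ₚ-irrefl {xOf (a₁ , b₂) (c , d)}
             (subst (λ b → xOf (a₁ , b) (c , d) <ₚ xOf (a₁ , b₂) (c , d)) (arc-uniqueʳ bκ mκ mγ) y<z))
  ... | mγ | tri< a₁<a₂ _ _ =
    ⊥-elim (<ₚ-asym {xOf (a₁ , b₁) (c , d)} {xOf (a₂ , b₂) (c , d)} y<z
             (meetX-inner-<-outerˡ a₁<a₂ a₂≤c c<b₂ (arc-nested bκ mκ mγ a₁<a₂ (≤-<-trans a₂≤c c<b₁)) b₁<d))
  ... | mγ | tri> _ _ a₂<a₁ =
    co-crossing-colour (inj₂ cγ) (inj₂ cκ) , a₂<a₁ , arc-nested bκ mγ mκ a₂<a₁ (≤-<-trans a₁≤c c<b₂)

  module _ (k j : Fin N) where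

    Encloses : Arc N → Set
    Encloses α = colour α ≡ w[ j ] × left α ≤ toℕ k × toℕ j ≤ right α

    EnclosingLeg : Leg → Set
    EnclosingLeg (leftward  α _)        = Encloses α
    EnclosingLeg (rightward _ (just κ)) = Encloses κ
    EnclosingLeg (rightward _ nothing)  = ⊥

    Completed : Leg → Set
    Completed s = Σ[ e ∈ Fin N ] Σ[ f ∈ Leg ]
                    (Star Step s f × Valid f × EnclosingLeg f × Stops f e × ReachesFrom s e)

    -- Terminates since the left endpoints of the enclosing arcs strictly decrease.
    complete-leftward : ∀ α m → Valid (leftward α m) → Encloses α → Acc _<_ (left α) →
                        Completed (leftward α m)
    complete-rightward : ∀ β κ → Valid (rightward β (just κ)) → Encloses κ → Acc _<_ (left κ) →
                         Completed (rightward β (just κ))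

    complete-leftward α m v enc rec with legResult (leftward α m) v
    ... | stops st r = _ , _ , ε , v , enc , st , r
    ... | turns {rightward β _} t@(turnL _ _ _) k
      with e , f , steps , vf , encf , st , r ← complete-rightward β α (Turn-valid v t) enc rec =
      e , f , (v , t) ◅ steps , vf , encf , st , k r

    complete-rightward β κ v enc@(κ≡j , lκ≤k , j≤rκ) (acc more) with legResult (rightward β (just κ)) v
    ... | stops st r = _ , _ , ε , v , enc , st , r
    ... | turns {leftward γ _} t@(turnR cγ y<z _) k
      with γ≡κ , lγ<lκ , rκ<rγ ← right-meeting-encloses v cγ y<z
      with e , f , steps , vf , encf , st , r ←
             complete-leftward γ (just β) (Turn-valid v t)
               (trans γ≡κ κ≡j , ≤-trans (<⇒≤ lγ<lκ) lκ≤k , ≤-trans j≤rκ (<⇒≤ rκ<rγ)) (more lγ<lκ) =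
      e , f , (v , t) ◅ steps , vf , encf , st , k r

  leftward-InU : ∀ {a b} m → Valid (leftward (a , b) m) → InU a b
  leftward-InU nothing  u           = u
  leftward-InU (just _) ((u , _) , _) = u

  rightward-InU : ∀ {a b} m → Valid (rightward (a , b) m) → InU a b
  rightward-InU nothing  (u , _)     = u
  rightward-InU (just _) (_ , u , _) = u

  left-<-entry : ∀ α m → Valid (leftward α m) → pt (left α) <ₚ entry (leftward α m)
  left-<-entry (_ , _) nothing  u          = pt-mono-< (InU-< u)
  left-<-entry α       (just σ) (c , lα<lσ) =
    <≤ₚ-trans {pt (left α)} {pt (left σ)} {xOf α σ} (xOf-proper c) (pt-mono-< lα<lσ) (left-≤-xOf c)

  -- The sibling arc at a, if longer, would meet the leg at a before the walk reaches a.
  stopsL-longest : ∀ {a b} m → Valid (leftward (a , b) m) → Stops (leftward (a , b) m) a →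
                   ∀ d → InU a d → d ≢ b → toℕ d < toℕ b
  stopsL-longest {a} {b} m v (stopsL noTurn) d u d≢b with <-cmp (toℕ d) (toℕ b)
  ... | tri< d<b _ _ = d<b
  ... | tri≈ _ d≡b _ = ⊥-elim (d≢b (toℕ-injective d≡b))
  ... | tri> _ _ b<d = ⊥-elim (noTurn (a , d) c
        (≤<ₚ-trans {xOf (a , b) (a , d)} {pt (toℕ a)} {entry (leftward (a , b) m)}
                   (xOf-proper c) (xOf-shared-≤-left c refl) (left-<-entry (a , b) m v)))
    where
    c : Crosses (a , b) (a , d)
    c = leftward-InU m v , u , ≤-refl , InU-< (leftward-InU m v) , b<d

  Step-injective : ∀ {u₁ u₂ v} → Step u₁ v → Step u₂ v → u₁ ≡ u₂
  Step-injective {leftward α nothing}  {leftward .α nothing}  (_ , turnL _ _ _) (_ , turnL _ _ _) = refl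
  Step-injective {leftward α (just σ)} {leftward .α nothing}  ((c , _) , turnL _ y<p _) (_ , turnL _ _ noTurn) =
    ⊥-elim (noTurn σ c y<p (xOf-<-right c))
  Step-injective {leftward α nothing}  {leftward .α (just σ)} (_ , turnL _ _ noTurn) ((c , _) , turnL _ y<p _) =
    ⊥-elim (noTurn σ c y<p (xOf-<-right c))
  Step-injective {leftward α (just σ₁)} {leftward .α (just σ₂)}
                 ((c₁ , _) , turnL _ y<p₁ noTurn₁) ((c₂ , _) , turnL _ y<p₂ noTurn₂) =
    cong (leftward α ∘ just)
         (proj₁ (Meets-unique (asFirst c₁) (asFirst c₂) (noTurn₂ σ₁ c₁ y<p₁) (noTurn₁ σ₂ c₂ y<p₂)))
  Step-injective {rightward β nothing}  {rightward .β nothing}  (_ , turnR _ _ _) (_ , turnR _ _ _) = refl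
  Step-injective {rightward β (just κ)} {rightward .β nothing}  (c , turnR _ _ _) ((_ , noCross) , turnR _ _ _) =
    ⊥-elim (noCross κ c)
  Step-injective {rightward β nothing}  {rightward .β (just κ)} ((_ , noCross) , turnR _ _ _) (c , turnR _ _ _) =
    ⊥-elim (noCross κ c)
  Step-injective {rightward β (just κ₁)} {rightward .β (just κ₂)}
                 (c₁ , turnR _ p<y₁ noTurn₁) (c₂ , turnR _ p<y₂ noTurn₂) =
    cong (rightward β ∘ just)
         (proj₁ (Meets-unique (asSecond c₁) (asSecond c₂) (λ y<z → noTurn₁ κ₂ c₂ y<z p<y₂)
                                                          (λ z<y → noTurn₂ κ₁ c₁ z<y p<y₁)))

  stopsL-entry-unique : ∀ {a b} m₁ m₂ → Valid (leftward (a , b) m₁) → Valid (leftward (a , b) m₂) →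
                        Stops (leftward (a , b) m₁) a → Stops (leftward (a , b) m₂) a → m₁ ≡ m₂
  stopsL-entry-unique nothing  nothing  _ _ _ _ = refl
  stopsL-entry-unique nothing  (just σ) _ (c , _) (stopsL noTurn) _ = ⊥-elim (noTurn σ c (xOf-<-right c))
  stopsL-entry-unique (just σ) nothing  (c , _) _ _ (stopsL noTurn) = ⊥-elim (noTurn σ c (xOf-<-right c))
  stopsL-entry-unique (just σ₁) (just σ₂) (c₁ , _) (c₂ , _) (stopsL noTurn₁) (stopsL noTurn₂) =
    cong just (proj₁ (Meets-unique (asFirst c₁) (asFirst c₂) (noTurn₂ σ₁ c₁) (noTurn₁ σ₂ c₂)))

  stopsR-entry-unique : ∀ {a b} m₁ m₂ → Valid (rightward (a , b) m₁) → Valid (rightward (a , b) m₂) →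
                        Stops (rightward (a , b) m₁) b → Stops (rightward (a , b) m₂) b → m₁ ≡ m₂
  stopsR-entry-unique nothing  nothing  _ _ _ _ = refl
  stopsR-entry-unique nothing  (just κ) (_ , noCross) c _ _ = ⊥-elim (noCross κ c)
  stopsR-entry-unique (just κ) nothing  c (_ , noCross) _ _ = ⊥-elim (noCross κ c)
  stopsR-entry-unique (just κ₁) (just κ₂) c₁ c₂ (stopsR noTurn₁) (stopsR noTurn₂) =
    cong just (proj₁ (Meets-unique (asSecond c₁) (asSecond c₂) (noTurn₁ κ₂ c₂) (noTurn₂ κ₁ c₁)))

  Stops-injective : ∀ {f₁ f₂ e} → Valid f₁ → Valid f₂ → Stops f₁ e → Stops f₂ e → f₁ ≡ f₂
  Stops-injective {leftward (a , b₁) m₁} {leftward (_ , b₂) m₂} v₁ v₂ st₁@(stopsL _) st₂@(stopsL _)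
    with b₁ ≟F b₂
  ... | yes refl = cong (leftward (a , b₁)) (stopsL-entry-unique m₁ m₂ v₁ v₂ st₁ st₂)
  ... | no b₁≢b₂ = ⊥-elim (<-asym (stopsL-longest m₁ v₁ st₁ b₂ (leftward-InU m₂ v₂) (b₁≢b₂ ∘ sym))
                                  (stopsL-longest m₂ v₂ st₂ b₁ (leftward-InU m₁ v₁) b₁≢b₂))
  Stops-injective {rightward (a₁ , b) m₁} {rightward (a₂ , _) m₂} v₁ v₂ st₁@(stopsR _) st₂@(stopsR _)
    with u₁ ← rightward-InU m₁ v₁ | u₂ ← rightward-InU m₂ v₂
    with refl ← arc-uniqueˡ (InU-BC u₁) (proj₂ (InU⇒M u₁)) (proj₂ (InU⇒M u₂)) =
    cong (rightward (a₁ , b)) (stopsR-entry-unique m₁ m₂ v₁ v₂ st₁ st₂)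
  Stops-injective {leftward (_ , _) m₁} {rightward (_ , _) m₂} v₁ v₂ (stopsL _) (stopsR _) =
    ⊥-elim (BC≢A (InU-BC (rightward-InU m₂ v₂)) (InU-leftA (leftward-InU m₁ v₁)))
  Stops-injective {rightward (_ , _) m₁} {leftward (_ , _) m₂} v₁ v₂ (stopsR _) (stopsL _) =
    ⊥-elim (BC≢A (InU-BC (rightward-InU m₁ v₁)) (InU-leftA (leftward-InU m₂ v₂)))

  Initial : Leg → Set
  Initial (leftward  _ nothing)  = ⊤
  Initial (rightward _ nothing)  = ⊤
  Initial (leftward  _ (just _)) = ⊥
  Initial (rightward _ (just _)) = ⊥

  Step-¬Initial : ∀ {u v} → Step u v → ¬ Initial v
  Step-¬Initial (_ , turnL _ _ _) ()
  Step-¬Initial (_ , turnR _ _ _) ()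

  -- The walk map

  start : Leg → Fin N
  start (leftward  (_ , b) _) = b
  start (rightward (a , _) _) = a

  Trace : Fin N → Fin N → Set
  Trace t e = Σ[ s ∈ Leg ] Σ[ f ∈ Leg ]
                (Initial s × start s ≡ t × Star Step s f × Valid f × Stops f e)

  Trace-injective : ∀ {t₁ t₂ e} → Trace t₁ e → Trace t₂ e → t₁ ≡ t₂
  Trace-injective (s₁ , f₁ , i₁ , refl , steps₁ , v₁ , st₁) (s₂ , f₂ , i₂ , refl , steps₂ , v₂ , st₂)
    with refl ← Stops-injective v₁ v₂ st₁ st₂
    with refl ← Star-initial-unique Step-injective Initial Step-¬Initial steps₁ steps₂ i₁ i₂ = refl

  Shortest : Fin N → Fin N → Set
  Shortest t e = InU t e × (∀ y → InU t y → toℕ e ≤ toℕ y)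

  arcs-at-A : ∀ t → w[ t ] ≡ A →
              Σ[ s ∈ Fin N ] Σ[ o ∈ Fin N ]
                (Shortest t s × InU t o × toℕ s < toℕ o × w[ o ] ≡ neg w[ s ])
  arcs-at-A t t≡A
    with b , mb ← rightPartner isB t t≡A | c , mc ← rightPartner isC t t≡A | <-cmp (toℕ b) (toℕ c)
  ... | tri< b<c _ _ = b , c , (inj₁ mb , shortest) , inj₂ mc , b<c ,
                       trans (arc-rightε isC mc) (cong neg (sym (arc-rightε isB mb)))
    where
    shortest : ∀ y → InU t y → toℕ b ≤ toℕ y
    shortest y (inj₁ m) = ≤-reflexive (cong toℕ (arc-uniqueʳ isB mb m))
    shortest y (inj₂ m) = ≤-trans (<⇒≤ b<c) (≤-reflexive (cong toℕ (arc-uniqueʳ isC mc m)))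
  ... | tri> _ _ c<b = c , b , (inj₂ mc , shortest) , inj₁ mb , c<b ,
                       trans (arc-rightε isB mb) (cong neg (sym (arc-rightε isC mc)))
    where
    shortest : ∀ y → InU t y → toℕ c ≤ toℕ y
    shortest y (inj₁ m) = ≤-trans (<⇒≤ c<b) (≤-reflexive (cong toℕ (arc-uniqueʳ isB mb m)))
    shortest y (inj₂ m) = ≤-reflexive (cong toℕ (arc-uniqueʳ isC mc m))
  ... | tri≈ _ b≡c _ with refl ← toℕ-injective b≡c
    with () ← trans (sym (arc-rightε isB mb)) (arc-rightε isC mc)

  shorter-uncrossed : ∀ {t s o} → InU t s → InU t o → toℕ s < toℕ o → w[ o ] ≡ neg w[ s ] →
                      ∀ δ → ¬ Crosses δ (t , s)
  shorter-uncrossed {t} {s} {o} us uo s<o o≡-s (a , b) c@(uδ , _ , a≤t , t<b , b<s)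
    with bδ , mδ ← InU⇒M uδ
    with mo ← recolour uo (trans o≡-s (sym (crossing-colour (inj₂ c)))) | m≤n⇒m<n∨m≡n a≤t
  ... | inj₁ a<t = arc-noncrossing bδ mδ mo (a<t , t<b , <-trans b<s s<o)
  ... | inj₂ a≡t with refl ← toℕ-injective a≡t =
    <-irrefl (cong toℕ (arc-uniqueʳ bδ mδ mo)) (<-trans b<s s<o)

  walk-from-A : ∀ t → w[ t ] ≡ A → Σ[ e ∈ Fin N ] (WalkFrom t e × Trace t e × Shortest t e)
  walk-from-A t t≡A
    with s , o , sh@(us , shortest) , uo , s<o , o≡-s ← arcs-at-A t t≡A
    with legResult (rightward (t , s) nothing) (us , shorter-uncrossed us uo s<o o≡-s)
  ... | stops st@(stopsR _) r =
    s , inj₁ (t≡A , s , us , shortest , r) ,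
    (rightward (t , s) nothing , _ , tt , refl , ε , (us , shorter-uncrossed us uo s<o o≡-s) , st) , sh
  ... | turns (turnR c _ _) _ = ⊥-elim (shorter-uncrossed us uo s<o o≡-s _ c)

  EndsBC : Fin N → Fin N → Set
  EndsBC j e = (w[ e ] ≡ A × toℕ e < toℕ j × (∀ x → Shortest e x → w[ x ] ≡ neg w[ j ]))
             ⊎ (w[ e ] ≡ neg w[ j ] × toℕ j < toℕ e)

  -- A final leftward leg ends at the A of an enclosing arc, which is then the longer arc there.
  final-leg : ∀ {k j e} → BC w[ j ] → toℕ k < toℕ j → ∀ f → Valid f → EnclosingLeg k j f → Stops f e →
              EndsBC j e
  final-leg {k} {j} bj k<j (leftward (a , b) m) v (ab≡j , a≤k , _) st@(stopsL _) =
    inj₁ (a≡A , ≤-<-trans a≤k k<j , λ x sh → ≢⇒≡neg bj (InU-BC (proj₁ sh)) (shortest-≢ x sh))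
    where
    a≡A : w[ a ] ≡ A
    a≡A = InU-leftA (leftward-InU m v)
    shortest-≢ : ∀ x → Shortest a x → w[ x ] ≢ w[ j ]
    shortest-≢ x (ux , shortest) x≡j
      with d , md ← rightPartner (neg-BC bj) a a≡A
      with refl ← arc-uniqueʳ bj (recolour ux x≡j) (recolour (leftward-InU m v) ab≡j) =
      ≤⇒≯ (shortest d (M⇒InU (neg-BC bj) md))
          (stopsL-longest m v st d (M⇒InU (neg-BC bj) md)
            λ { refl → neg-≢ bj (trans (sym (arc-rightε (neg-BC bj) md)) x≡j) })
  final-leg bj _ (rightward (a , b) (just κ)) c@(_ , _ , _ , _ , rκ<b) (κ≡j , _ , j≤rκ) (stopsR _) =
    inj₂ (trans (crossing-colour (inj₁ c)) (cong neg κ≡j) , ≤-<-trans j≤rκ rκ<b)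
  final-leg _ _ (rightward _ nothing) _ () _

  walk-from-BC : ∀ j → BC w[ j ] → Σ[ e ∈ Fin N ] (WalkFrom j e × Trace j e × EndsBC j e)
  walk-from-BC j bj
    with k , mk ← leftPartner bj j refl
    with e , f , steps , vf , enc , st , r ←
           complete-leftward k j (k , j) nothing (M⇒InU bj mk) (refl , ≤-refl , ≤-refl) (<-wellFounded _) =
    e , inj₂ (BC≢A bj , k , M⇒InU bj mk , r) ,
    (leftward (k , j) nothing , f , tt , refl , steps , vf , st) ,
    final-leg bj (arc-< bj mk) f vf enc st

  Outcome : Fin N → Fin N → Set
  Outcome t e = (w[ t ] ≡ A × Shortest t e) ⊎ (BC w[ t ] × EndsBC t e)

  walk : ∀ t → Σ[ e ∈ Fin N ] (WalkFrom t e × Trace t e × Outcome t e)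
  walk t with BC? w[ t ]
  ... | inj₁ bt  with e , from , trace , ends ← walk-from-BC t bt = e , from , trace , inj₂ (bt , ends)
  ... | inj₂ t≡A with e , from , trace , sh ← walk-from-A t t≡A = e , from , trace , inj₁ (t≡A , sh)

  walkMap : Fin N → Fin N
  walkMap t = proj₁ (walk t)

  walkMap-outcome : ∀ t → Outcome t (walkMap t)
  walkMap-outcome t = proj₂ (proj₂ (proj₂ (walk t)))

  walk-trace : ∀ t → Trace t (walkMap t)
  walk-trace t = proj₁ (proj₂ (proj₂ (walk t)))

  walkMap-injective : ∀ {x y} → walkMap x ≡ walkMap y → x ≡ y
  walkMap-injective {x} {y} eq =
    Trace-injective (walk-trace x) (subst (Trace y) (sym eq) (walk-trace y))

  σ : Permutation′ N
  σ = injective⇒permutation walkMap walkMap-injective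

  σ-walks : ∀ i → WalkFrom i (σ ⟨$⟩ʳ i)
  σ-walks i = proj₁ (proj₂ (walk i))

  WalkFrom-functional : ∀ {i j j′} → WalkFrom i j → WalkFrom i j′ → j ≡ j′
  WalkFrom-functional (inj₁ (_ , i₁ , u₁ , shortest₁ , r₁)) (inj₁ (_ , i₂ , u₂ , shortest₂ , r₂))
    with refl ← toℕ-injective (≤-antisym (shortest₁ i₂ u₂) (shortest₂ i₁ u₁)) = Reaches-functional r₁ r₂
  WalkFrom-functional (inj₂ (_ , k₁ , u₁ , r₁)) (inj₂ (_ , k₂ , u₂ , r₂))
    with refl ← arc-uniqueˡ (InU-BC u₁) (proj₂ (InU⇒M u₁)) (proj₂ (InU⇒M u₂)) = Reaches-functional r₁ r₂
  WalkFrom-functional (inj₁ (i≡A , _)) (inj₂ (i≢A , _)) = ⊥-elim (i≢A i≡A)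
  WalkFrom-functional (inj₂ (i≢A , _)) (inj₁ (i≡A , _)) = ⊥-elim (i≢A i≡A)

  σ-A : ∀ i → w[ i ] ≡ A → BC w[ σ ⟨$⟩ʳ i ]
  σ-A i i≡A with walkMap-outcome i
  ... | inj₁ (_ , u , _)   = InU-BC u
  ... | inj₂ (bi , _)      = ⊥-elim (BC≢A bi i≡A)

  σ-BC : ∀ i → BC w[ i ] →
         w[ σ ⟨$⟩ʳ i ] ≡ neg w[ i ] ⊎ (w[ σ ⟨$⟩ʳ i ] ≡ A × w[ σ ⟨$⟩ʳ (σ ⟨$⟩ʳ i) ] ≡ neg w[ i ])
  σ-BC i bi with walkMap-outcome i
  ... | inj₁ (i≡A , _)                       = ⊥-elim (BC≢A bi i≡A)
  ... | inj₂ (_ , inj₂ (e≡-i , _))           = inj₁ e≡-i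
  ... | inj₂ (_ , inj₁ (e≡A , _ , shortest-≡-i)) with walkMap-outcome (walkMap i)
  ...   | inj₁ (_ , sh) = inj₂ (e≡A , shortest-≡-i _ sh)
  ...   | inj₂ (be , _) = ⊥-elim (BC≢A be e≡A)

  σ-direction : ∀ t → (t <F σ ⟨$⟩ʳ t × w[ σ ⟨$⟩ʳ t ] ≢ A) ⊎ (σ ⟨$⟩ʳ t <F t × w[ σ ⟨$⟩ʳ t ] ≡ A)
  σ-direction t with walkMap-outcome t
  ... | inj₁ (_ , u , _)                 = inj₁ (InU-< u , BC≢A (InU-BC u))
  ... | inj₂ (_ , inj₁ (e≡A , e<t , _))  = inj₂ (e<t , e≡A)
  ... | inj₂ (bt , inj₂ (e≡-t , t<e))    = inj₁ (t<e , BC≢A (subst BC (sym e≡-t) (neg-BC bt)))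

  σ⁻¹-direction : ∀ i → (σ ⟨$⟩ˡ i <F i × w[ i ] ≢ A) ⊎ (i <F σ ⟨$⟩ˡ i × w[ i ] ≡ A)
  σ⁻¹-direction i = subst (λ j → (σ ⟨$⟩ˡ i <F j × w[ j ] ≢ A) ⊎ (j <F σ ⟨$⟩ˡ i × w[ j ] ≡ A))
                          (inverseʳ σ) (σ-direction (σ ⟨$⟩ˡ i))

  A⇔σ⁻¹-right : ∀ i → (w[ i ] ≡ A) ⇔ (i <F σ ⟨$⟩ˡ i)
  A⇔σ⁻¹-right i with σ⁻¹-direction i
  ... | inj₁ (t<i , i≢A) = mk⇔ (⊥-elim ∘ i≢A) (λ i<t → ⊥-elim (<-asym t<i i<t))
  ... | inj₂ (i<t , i≡A) = mk⇔ (λ _ → i<t) (λ _ → i≡A)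

  BC⇔σ⁻¹-left : ∀ i → BC w[ i ] ⇔ (σ ⟨$⟩ˡ i <F i)
  BC⇔σ⁻¹-left i with σ⁻¹-direction i
  ... | inj₁ (t<i , i≢A) = mk⇔ (λ _ → t<i) (λ _ → ≢A⇒BC i≢A)
  ... | inj₂ (i<t , i≡A) = mk⇔ (λ bi → ⊥-elim (BC≢A bi i≡A)) (λ t<i → ⊥-elim (<-asym t<i i<t))

  σ-no-fixed-point : ∀ i → σ ⟨$⟩ʳ i ≢ i
  σ-no-fixed-point i σi≡i with σ-direction i
  ... | inj₁ (i<σi , _) = <-irrefl (cong toℕ (sym σi≡i)) i<σi
  ... | inj₂ (σi<i , _) = <-irrefl (cong toℕ σi≡i) σi<i

proposition3p8 : (n : ℕ) → 1 ≤ n → (w : Vec Letter (3 * n)) → IsKreweras n w →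
    (MB MC : Fin (3 * n) → Fin (3 * n) → Set) →
    IsNCMatching w B MB → IsNCMatching w C MC →
    Σ[ σ ∈ Permutation′ (3 * n) ]
      -- σ is the walk map σ_w (the walk from i is finite and ends at σ i)
      ((∀ i → Walk.WalkFrom w MB MC i (σ ⟨$⟩ʳ i)) ×
       (∀ i j → Walk.WalkFrom w MB MC i j → j ≡ σ ⟨$⟩ʳ i) ×
      -- (b)
       (∀ i → letter w i ≡ A → letter w (σ ⟨$⟩ʳ i) ≡ B ⊎ letter w (σ ⟨$⟩ʳ i) ≡ C) ×
      -- (c)
       (∀ i → letter w i ≡ B ⊎ letter w i ≡ C →
          letter w (σ ⟨$⟩ʳ i) ≡ neg (letter w i)
          ⊎ (letter w (σ ⟨$⟩ʳ i) ≡ A × letter w (σ ⟨$⟩ʳ (σ ⟨$⟩ʳ i)) ≡ neg (letter w i))) ×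
      -- (d)
       (∀ i → (letter w i ≡ A) ⇔ (i <F σ ⟨$⟩ˡ i)) ×
       (∀ i → (letter w i ≡ B ⊎ letter w i ≡ C) ⇔ (σ ⟨$⟩ˡ i <F i)) ×
       (∀ i → σ ⟨$⟩ʳ i ≢ i))
proposition3p8 n _ w _ MB MC hB hC =
  σ ,
  σ-walks ,
  (λ i j from-i → WalkFrom-functional from-i (σ-walks i)) ,
  (λ i i≡A → Equivalence.to BC⇔≡B⊎≡C (σ-A i i≡A)) ,
  (λ i bi → σ-BC i (Equivalence.from BC⇔≡B⊎≡C bi)) ,
  A⇔σ⁻¹-right ,
  (λ i → ⇔-trans (⇔-sym BC⇔≡B⊎≡C) (BC⇔σ⁻¹-left i)) ,
  σ-no-fixed-point
  where open WalkAnalysis w MB MC hB hC
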